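{- Let $\mathbf{k}=(k_1,\ldots,k_r)$ be any index (a finite, possibly empty, tuple of positive integers) and let $N$ be any positive integer. Then \[\zeta^\star_{<N}(\mathbf{k})=\zeta^{\star\flat}_{<N}(\mathbf{k}),\] where \[\zeta^\star_{<N}(\mathbf{k})=\sum_{0<m_1\le\cdots\le m_r<N}\frac{1}{m_1^{k_1}\cdots m_r^{k_r}}\] and \[\zeta^{\star\flat}_{<N}(\mathbf{k})=\sum\prod_{i=1}^r\frac{1}{(N-n_{i1})\,n_{i2}\cdots n_{ik_i}},\] the latter sum running over all integers $n_{ij}$ ($1\le i\le r$, $1\le j\le k_i$) satisfying $0<n_{i1}\le n_{i2}\le\cdots\le n_{ik_i}<N$ for each $1\le i\le r$ and $n_{(i-1)1}\le n_{ik_i}$ for each $2\le i\le r$.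
   Context: The sums are over integers. For the empty index ($r=0$) both $\zeta^\star_{<N}(\varnothing)$ and $\zeta^{\star\flat}_{<N}(\varnothing)$ are defined to be $1$. -}

module Defs where

open import Data.Bool using (Bool; true; false; _∧_)
open import Data.Nat using (ℕ; zero; suc; _∸_; _≤ᵇ_; _<ᵇ_)
open import Data.List using (List; []; _∷_; map; concatMap; filterᵇ; upTo; foldr)
open import Data.Bool.ListAction using (and)
open import Data.Integer using (+_)
open import Data.Rational using (ℚ; _/_; _+_; _*_; 0ℚ; 1ℚ)

sumℚ : List ℚ → ℚ
sumℚ = foldr _+_ 0ℚ

prodℚ : List ℚ → ℚ
prodℚ = foldr _*_ 1ℚ

-- 1/m for m > 0 (value at 0 is an unused junk value 0; every use below is
-- guarded by conditions forcing a positive argument).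
inv : ℕ → ℚ
inv zero    = 0ℚ
inv (suc m) = + 1 / suc m

invPow : ℕ → ℕ → ℚ
invPow m zero    = 1ℚ
invPow m (suc k) = inv m * invPow m k

tuples : {A : Set} → List A → ℕ → List (List A)
tuples R zero    = [] ∷ []
tuples R (suc r) = concatMap (λ x → map (x ∷_) (tuples R r)) R

shaped : {A : Set} → List A → List ℕ → List (List (List A))
shaped R []       = [] ∷ []
shaped R (k ∷ ks) = concatMap (λ row → map (row ∷_) (shaped R ks)) (tuples R k)

allPosBelow : ℕ → List ℕ → Bool
allPosBelow N xs = and (map (λ x → (0 <ᵇ x) ∧ (x <ᵇ N)) xs)

nondecr : List ℕ → Bool
nondecr []           = true
nondecr (x ∷ [])     = true
nondecr (x ∷ y ∷ xs) = (x ≤ᵇ y) ∧ nondecr (y ∷ xs)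

zipProd : List ℕ → List ℕ → List ℚ
zipProd (m ∷ ms) (k ∷ ks) = invPow m k ∷ zipProd ms ks
zipProd _ _ = []

-- Candidate integers: 0 .. N (the conditions 0 < m < N cut out the real range;
-- all integers outside this window violate the conditions anyway).
cand : ℕ → List ℕ
cand N = upTo (suc N)

zetaStar : ℕ → List ℕ → ℚ
zetaStar N ks =
  sumℚ (map (λ ms → prodℚ (zipProd ms ks))
            (filterᵇ (λ ms → allPosBelow N ms ∧ nondecr ms)
                     (tuples (cand N) (Data.List.length ks))))

-- first / last entry of a row (default 0 for an empty row; rows are nonempty
-- since every k_i ≥ 1)
firstE : List ℕ → ℕ
firstE []      = 0
firstE (x ∷ _) = x

lastE : List ℕ → ℕ
lastE []           = 0
lastE (x ∷ [])     = x
lastE (x ∷ y ∷ xs) = lastE (y ∷ xs)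

linked : List (List ℕ) → Bool
linked []             = true
linked (r ∷ [])       = true
linked (r ∷ s ∷ rows) = (firstE r ≤ᵇ lastE s) ∧ linked (s ∷ rows)

rowTerm : ℕ → List ℕ → ℚ
rowTerm N []       = 1ℚ
rowTerm N (n ∷ ns) = inv (N ∸ n) * prodℚ (map inv ns)

rowOK : ℕ → List ℕ → Bool
rowOK N row = allPosBelow N row ∧ nondecr row

zetaStarFlat : ℕ → List ℕ → ℚ
zetaStarFlat N ks =
  sumℚ (map (λ rows → prodℚ (map (rowTerm N) rows))
            (filterᵇ (λ rows → and (map (rowOK N) rows) ∧ linked rows)
                     (shaped (cand N) ks)))

-- Put N = M + 1 and K(u,v) = C(u,v) / ((v+1)·C(M,v+1)) for u, v < M, the index u standing for the
-- value u + 1. Restrict ζ⋆ to m₁ ≥ lo and ζ⋆♭ to n_{1k₁} ≥ y. By induction on the index k one shows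
-- that for every w < M
--   ζ⋆♭_{≥w+1}(k) / (M − w) = Σ_v K(w,v) · ζ⋆_{≥v+1}(k).
-- For the empty index this says that the rows of K sum to 1/(M − w). In the inductive step the first
-- row of ζ⋆♭ is peeled off: the column-prefix identity Σ_{u≤n} K(u,v) = (n+1)/(v+1) · K(n,v) turns its
-- entries n_{12}, …, n_{1k₁} into the factor 1/(v+1)^{k₁−1}, and since a row prefix of K is
-- proportional to a column suffix, the factor 1/(N − n_{11}) is absorbed. As the columns of K sum to
-- 1/(v+1), the same first-row computation with y = 0 yields the theorem. All kernel identities come
-- from the hockey-stick identity and the absorption identity (k+1)·C(n,k+1) = (n−k)·C(n,k).

module Submission where

open import Defs
open import Data.Nat using (ℕ; _<_)
open import Data.List using (List)
open import Data.List.Relation.Unary.All using (All)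
open import Relation.Binary.PropositionalEquality using (_≡_)

open import Algebra.Bundles using (CommutativeMonoid; CommutativeRing)
open import Data.Bool using (Bool; true; false; _∧_)
open import Data.Bool.Properties using (∧-assoc; ∧-commutativeMonoid)
open import Data.Nat using (zero; suc; _≤_; z≤n; s≤s; _≤ᵇ_; _<ᵇ_; _∸_)
import Data.Nat as ℕ
import Data.Nat.Properties as ℕ
open import Data.Nat.Combinatorics using (_C_; k>n⇒nCk≡0; nC1≡n; nCk+nC[k+1]≡[n+1]C[k+1])
import Data.Integer as ℤ
import Data.Integer.Properties as ℤ
open import Data.List using ([]; _∷_; map; concatMap; filterᵇ; upTo; applyUpTo; _++_; length)
import Data.List.Properties as List
open import Data.List.Relation.Unary.All using ([]; _∷_)
open import Data.Bool.ListAction using (and)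
open import Data.Rational using (ℚ; _+_; _*_; _-_; 0ℚ; 1ℚ; toℚᵘ)
open import Data.Rational.Properties
  using ( +-assoc; +-comm; +-identityˡ; +-identityʳ; *-assoc; *-comm; *-identityˡ; *-identityʳ
        ; *-distribˡ-+; *-zeroˡ; *-zeroʳ; +-*-commutativeRing
        ; toℚᵘ-homo-+; toℚᵘ-homo-*; toℚᵘ-injective; toℚᵘ-fromℚᵘ)
import Data.Rational.Unnormalised as ℚᵘ
import Data.Rational.Unnormalised.Properties as ℚᵘ
open import Data.Rational.Solver using (module +-*-Solver)
open +-*-Solver using (solve; _:+_; _:*_; _:-_; _:=_; con)
open import Algebra.Properties.Semiring.Mult (CommutativeRing.semiring +-*-commutativeRing)
  using (_×_; ×-homo-+; ×1-homo-*)
open import Algebra.Properties.CommutativeSemigroup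
  (CommutativeMonoid.commutativeSemigroup ∧-commutativeMonoid) using () renaming (interchange to ∧-interchange)
open import Data.Sum using (inj₁; inj₂)
open import Function using (_∘_)
open import Relation.Nullary.Reflects using (ofʸ; ofⁿ; det; fromEquivalence)
open import Relation.Binary.PropositionalEquality using (refl; sym; trans; cong; cong₂; subst; module ≡-Reasoning)
open ≡-Reasoning

Σ< : ℕ → (ℕ → ℚ) → ℚ
Σ< zero    f = 0ℚ
Σ< (suc n) f = Σ< n f + f n

Σ<-cong-< : ∀ n {f g : ℕ → ℚ} → (∀ i → i < n → f i ≡ g i) → Σ< n f ≡ Σ< n g
Σ<-cong-< zero    eq = refl
Σ<-cong-< (suc n) eq = cong₂ _+_ (Σ<-cong-< n (λ i i<n → eq i (ℕ.m<n⇒m<1+n i<n))) (eq n ℕ.≤-refl)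

Σ<-cong : ∀ n {f g : ℕ → ℚ} → (∀ i → f i ≡ g i) → Σ< n f ≡ Σ< n g
Σ<-cong n eq = Σ<-cong-< n (λ i _ → eq i)

Σ<-zero : ∀ n → Σ< n (λ _ → 0ℚ) ≡ 0ℚ
Σ<-zero zero    = refl
Σ<-zero (suc n) = trans (+-identityʳ _) (Σ<-zero n)

Σ<-distrib-+ : ∀ n (f g : ℕ → ℚ) → Σ< n (λ i → f i + g i) ≡ Σ< n f + Σ< n g
Σ<-distrib-+ zero    f g = refl
Σ<-distrib-+ (suc n) f g = begin
  Σ< n (λ i → f i + g i) + (f n + g n) ≡⟨ cong (_+ (f n + g n)) (Σ<-distrib-+ n f g) ⟩
  (Σ< n f + Σ< n g) + (f n + g n)      ≡⟨ solve 4 (λ a b c d → (a :+ b) :+ (c :+ d) := (a :+ c) :+ (b :+ d))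
                                                  refl (Σ< n f) (Σ< n g) (f n) (g n) ⟩
  (Σ< n f + f n) + (Σ< n g + g n)      ∎

*-distribˡ-Σ< : ∀ n c (f : ℕ → ℚ) → c * Σ< n f ≡ Σ< n (λ i → c * f i)
*-distribˡ-Σ< zero    c f = *-zeroʳ c
*-distribˡ-Σ< (suc n) c f = trans (*-distribˡ-+ c (Σ< n f) (f n)) (cong (_+ c * f n) (*-distribˡ-Σ< n c f))

*-distribʳ-Σ< : ∀ n c (f : ℕ → ℚ) → Σ< n f * c ≡ Σ< n (λ i → f i * c)
*-distribʳ-Σ< n c f = trans (*-comm (Σ< n f) c) (trans (*-distribˡ-Σ< n c f) (Σ<-cong n (λ i → *-comm c (f i))))

Σ<-comm : ∀ n m (f : ℕ → ℕ → ℚ) → Σ< n (λ i → Σ< m (f i)) ≡ Σ< m (λ j → Σ< n (λ i → f i j))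
Σ<-comm zero    m f = sym (Σ<-zero m)
Σ<-comm (suc n) m f = trans (cong (_+ Σ< m (f n)) (Σ<-comm n m f)) (sym (Σ<-distrib-+ m _ (f n)))

Σ<-sucˡ : ∀ n (f : ℕ → ℚ) → Σ< (suc n) f ≡ f 0 + Σ< n (f ∘ suc)
Σ<-sucˡ zero    f = +-comm 0ℚ (f 0)
Σ<-sucˡ (suc n) f = trans (cong (_+ f (suc n)) (Σ<-sucˡ n f)) (+-assoc (f 0) _ _)

infixl 6.5 _when_

_when_ : ℚ → Bool → ℚ
q when true  = q
q when false = 0ℚ

when-∧ : ∀ a b q → q when (a ∧ b) ≡ (q when b) when a
when-∧ true  b q = refl
when-∧ false b q = refl

*-when : ∀ b c q → c * (q when b) ≡ (c * q) when b
*-when true  c q = refl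
*-when false c q = *-zeroʳ c

when-* : ∀ b c q → (q when b) * c ≡ (q * c) when b
when-* true  c q = refl
when-* false c q = *-zeroˡ c

when-split : ∀ a b u v → (u * v) when (a ∧ b) ≡ (u * (v when b)) when a
when-split a b u v = trans (when-∧ a b (u * v)) (cong (_when a) (sym (*-when b u v)))

Σ<-when-false : ∀ n (b : ℕ → Bool) (f : ℕ → ℚ) → (∀ i → i < n → b i ≡ false) → Σ< n (λ i → f i when b i) ≡ 0ℚ
Σ<-when-false n b f b≡false = trans (Σ<-cong-< n (λ i i<n → cong (f i when_) (b≡false i i<n))) (Σ<-zero n)

≤ᵇ-true : ∀ {m n} → m ≤ n → (m ≤ᵇ n) ≡ true
≤ᵇ-true {m} {n} m≤n = det (ℕ.≤ᵇ-reflects-≤ m n) (ofʸ m≤n)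

≤ᵇ-false : ∀ {m n} → n < m → (m ≤ᵇ n) ≡ false
≤ᵇ-false {m} {n} n<m = det (ℕ.≤ᵇ-reflects-≤ m n) (ofⁿ (ℕ.<⇒≱ n<m))

≤ᵇ-suc : ∀ m n → (suc m ≤ᵇ suc n) ≡ (m ≤ᵇ n)
≤ᵇ-suc m n = det (ℕ.≤ᵇ-reflects-≤ (suc m) (suc n))
                 (fromEquivalence (s≤s ∘ ℕ.≤ᵇ⇒≤ m n) (ℕ.≤⇒≤ᵇ ∘ ℕ.≤-pred))

<ᵇ-true : ∀ {m n} → m < n → (m <ᵇ n) ≡ true
<ᵇ-true {m} {n} m<n = det (ℕ.<ᵇ-reflects-< m n) (ofʸ m<n)

<ᵇ-irrefl : ∀ n → (n <ᵇ n) ≡ false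
<ᵇ-irrefl n = det (ℕ.<ᵇ-reflects-< n n) (ofⁿ (ℕ.<-irrefl refl))

Σ<-when-≤ᵇ : ∀ R n (f : ℕ → ℚ) → n < R → Σ< R (λ i → f i when (i ≤ᵇ n)) ≡ Σ< (suc n) f
Σ<-when-≤ᵇ (suc R) n f n<1+R with ℕ.m≤n⇒m<n∨m≡n n<1+R
... | inj₁ (s≤s n<R) = begin
  Σ< R (λ i → f i when (i ≤ᵇ n)) + f R when (R ≤ᵇ n) ≡⟨ cong₂ _+_ (Σ<-when-≤ᵇ R n f n<R) (cong (f R when_) (≤ᵇ-false n<R)) ⟩
  Σ< (suc n) f + 0ℚ                                   ≡⟨ +-identityʳ _ ⟩
  Σ< (suc n) f                                        ∎
... | inj₂ refl = cong₂ _+_ (Σ<-cong-< R (λ i i<R → cong (f i when_) (≤ᵇ-true (ℕ.<⇒≤ i<R))))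
                            (cong (f n when_) (≤ᵇ-true (ℕ.≤-refl {n})))

Σ<-when-≥ᵇ : ∀ R l (f : ℕ → ℚ) → l ≤ R → Σ< R (λ i → f i when (l ≤ᵇ i)) + Σ< l f ≡ Σ< R f
Σ<-when-≥ᵇ zero    .zero f z≤n = +-identityʳ 0ℚ
Σ<-when-≥ᵇ (suc R) l    f l≤1+R with ℕ.m≤n⇒m<n∨m≡n l≤1+R
... | inj₁ (s≤s l≤R) = begin
  (S + f R when (l ≤ᵇ R)) + Σ< l f ≡⟨ cong (λ z → (S + z) + Σ< l f) (cong (f R when_) (≤ᵇ-true l≤R)) ⟩
  (S + f R) + Σ< l f               ≡⟨ solve 3 (λ a b c → (a :+ b) :+ c := (a :+ c) :+ b) refl S (f R) (Σ< l f) ⟩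
  (S + Σ< l f) + f R               ≡⟨ cong (_+ f R) (Σ<-when-≥ᵇ R l f l≤R) ⟩
  Σ< R f + f R                     ∎
  where S = Σ< R (λ i → f i when (l ≤ᵇ i))
... | inj₂ refl = begin
  (Σ< R (λ i → f i when (suc R ≤ᵇ i)) + f R when (suc R ≤ᵇ R)) + Σ< (suc R) f
    ≡⟨ cong (_+ Σ< (suc R) f) (cong₂ _+_ (Σ<-when-false R _ f (λ i i<R → ≤ᵇ-false (ℕ.m<n⇒m<1+n i<R)))
                                        (cong (f R when_) (≤ᵇ-false (ℕ.n<1+n R)))) ⟩
  (0ℚ + 0ℚ) + Σ< (suc R) f
    ≡⟨ +-identityˡ _ ⟩
  Σ< (suc R) f ∎

Σ<-triangle : ∀ n (f g : ℕ → ℚ) →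
  Σ< n (λ i → f i * Σ< n (λ j → g j when (i ≤ᵇ j))) ≡ Σ< n (λ j → Σ< n (λ i → f i when (i ≤ᵇ j)) * g j)
Σ<-triangle n f g = begin
  Σ< n (λ i → f i * Σ< n (λ j → g j when (i ≤ᵇ j)))  ≡⟨ Σ<-cong n (λ i → trans (*-distribˡ-Σ< n (f i) _)
                                                                          (Σ<-cong n (λ j → *-when (i ≤ᵇ j) (f i) (g j)))) ⟩
  Σ< n (λ i → Σ< n (λ j → f i * g j when (i ≤ᵇ j)))  ≡⟨ Σ<-comm n n _ ⟩
  Σ< n (λ j → Σ< n (λ i → f i * g j when (i ≤ᵇ j)))  ≡⟨ Σ<-cong n (λ j → sym (trans (*-distribʳ-Σ< n (g j) _)
                                                                                (Σ<-cong n (λ i → when-* (i ≤ᵇ j) (g j) (f i))))) ⟩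
  Σ< n (λ j → Σ< n (λ i → f i when (i ≤ᵇ j)) * g j)  ∎

⌜_⌝ : ℕ → ℚ
⌜ n ⌝ = n × 1ℚ

⌜⌝-homo-+ : ∀ m n → ⌜ m ℕ.+ n ⌝ ≡ ⌜ m ⌝ + ⌜ n ⌝
⌜⌝-homo-+ = ×-homo-+ 1ℚ

⌜⌝-homo-* : ∀ m n → ⌜ m ℕ.* n ⌝ ≡ ⌜ m ⌝ * ⌜ n ⌝
⌜⌝-homo-* = ×1-homo-*

⌜⌝-homo-∸ : ∀ {m n} → n ≤ m → ⌜ m ∸ n ⌝ ≡ ⌜ m ⌝ - ⌜ n ⌝
⌜⌝-homo-∸ {m} {n} n≤m = begin
  ⌜ m ∸ n ⌝                   ≡⟨ solve 2 (λ a b → a := (a :+ b) :- b) refl ⌜ m ∸ n ⌝ ⌜ n ⌝ ⟩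
  (⌜ m ∸ n ⌝ + ⌜ n ⌝) - ⌜ n ⌝ ≡⟨ cong (_- ⌜ n ⌝) (sym (⌜⌝-homo-+ (m ∸ n) n)) ⟩
  ⌜ m ∸ n ℕ.+ n ⌝ - ⌜ n ⌝     ≡⟨ cong (λ z → ⌜ z ⌝ - ⌜ n ⌝) (ℕ.m∸n+n≡m n≤m) ⟩
  ⌜ m ⌝ - ⌜ n ⌝               ∎

toℚᵘ-⌜⌝ : ∀ n → toℚᵘ ⌜ n ⌝ ℚᵘ.≃ ℚᵘ.mkℚᵘ (ℤ.+ n) 0
toℚᵘ-⌜⌝ zero    = ℚᵘ.≃-refl
toℚᵘ-⌜⌝ (suc n) = ℚᵘ.≃-trans (toℚᵘ-homo-+ 1ℚ ⌜ n ⌝)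
  (ℚᵘ.≃-trans (ℚᵘ.+-congʳ (toℚᵘ 1ℚ) (toℚᵘ-⌜⌝ n))
              (ℚᵘ.*≡* (cong (λ z → (ℤ.+ 1 ℤ.+ z) ℤ.* ℤ.+ 1) (ℤ.*-identityʳ (ℤ.+ n)))))

⌜⌝*inv≡1 : ∀ {n} → 0 < n → ⌜ n ⌝ * inv n ≡ 1ℚ
⌜⌝*inv≡1 {suc m} _ = toℚᵘ-injective
  (ℚᵘ.≃-trans (toℚᵘ-homo-* ⌜ suc m ⌝ (inv (suc m)))
  (ℚᵘ.≃-trans (ℚᵘ.*-cong (toℚᵘ-⌜⌝ (suc m)) (toℚᵘ-fromℚᵘ (ℚᵘ.mkℚᵘ (ℤ.+ 1) m)))
              (ℚᵘ.*-inverseʳ (ℚᵘ.mkℚᵘ (ℤ.+ suc m) 0))))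

⌜⌝*x≡y⇒x≡y*inv : ∀ {n} x y → 0 < n → ⌜ n ⌝ * x ≡ y → x ≡ y * inv n
⌜⌝*x≡y⇒x≡y*inv {n} x y 0<n eq = begin
  x                   ≡⟨ sym (*-identityʳ x) ⟩
  x * 1ℚ              ≡⟨ cong (x *_) (sym (⌜⌝*inv≡1 0<n)) ⟩
  x * (⌜ n ⌝ * inv n) ≡⟨ solve 3 (λ x a b → x :* (a :* b) := (a :* x) :* b) refl x ⌜ n ⌝ (inv n) ⟩
  (⌜ n ⌝ * x) * inv n ≡⟨ cong (_* inv n) eq ⟩
  y * inv n           ∎

-- Binomial coefficients

0<nCk : ∀ {n k} → k ≤ n → 0 < n C k
0<nCk {n}     {zero}  _         = s≤s z≤n
0<nCk {suc n} {suc k} (s≤s k≤n) = subst (0 <_) (nCk+nC[k+1]≡[n+1]C[k+1] n k)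
                                        (ℕ.<-≤-trans (0<nCk k≤n) (ℕ.m≤m+n (n C k) _))

[k+1][n+1]C[k+1]≡[n+1]nCk : ∀ n k → suc k ℕ.* (suc n C suc k) ≡ suc n ℕ.* (n C k)
[k+1][n+1]C[k+1]≡[n+1]nCk n       zero    = trans (ℕ.+-identityʳ (suc n C 1)) (trans (nC1≡n (suc n)) (sym (ℕ.*-identityʳ (suc n))))
[k+1][n+1]C[k+1]≡[n+1]nCk zero    (suc k) =
  trans (cong (suc (suc k) ℕ.*_) (k>n⇒nCk≡0 {1} {suc (suc k)} (s≤s (s≤s z≤n)))) (ℕ.*-zeroʳ (suc (suc k)))
[k+1][n+1]C[k+1]≡[n+1]nCk (suc n) (suc k) = begin
  suc (suc k) ℕ.* (suc (suc n) C suc (suc k))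
    ≡⟨ cong (suc (suc k) ℕ.*_) (sym (nCk+nC[k+1]≡[n+1]C[k+1] (suc n) (suc k))) ⟩
  suc (suc k) ℕ.* (a ℕ.+ suc n C suc (suc k))
    ≡⟨ ℕ.*-distribˡ-+ (suc (suc k)) a _ ⟩
  (a ℕ.+ suc k ℕ.* a) ℕ.+ suc (suc k) ℕ.* (suc n C suc (suc k))
    ≡⟨ cong₂ (λ x y → (a ℕ.+ x) ℕ.+ y) ([k+1][n+1]C[k+1]≡[n+1]nCk n k) ([k+1][n+1]C[k+1]≡[n+1]nCk n (suc k)) ⟩
  (a ℕ.+ suc n ℕ.* (n C k)) ℕ.+ suc n ℕ.* (n C suc k)
    ≡⟨ ℕ.+-assoc a _ _ ⟩
  a ℕ.+ (suc n ℕ.* (n C k) ℕ.+ suc n ℕ.* (n C suc k))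
    ≡⟨ cong (a ℕ.+_) (sym (ℕ.*-distribˡ-+ (suc n) (n C k) (n C suc k))) ⟩
  a ℕ.+ suc n ℕ.* (n C k ℕ.+ n C suc k)
    ≡⟨ cong (λ x → a ℕ.+ suc n ℕ.* x) (nCk+nC[k+1]≡[n+1]C[k+1] n k) ⟩
  suc (suc n) ℕ.* a ∎
  where a = suc n C suc k

hockey-stick : ∀ n k → Σ< n (λ a → ⌜ a C k ⌝) ≡ ⌜ n C suc k ⌝
hockey-stick zero    k = refl
hockey-stick (suc n) k = begin
  Σ< n (λ a → ⌜ a C k ⌝) + ⌜ n C k ⌝ ≡⟨ cong (_+ ⌜ n C k ⌝) (hockey-stick n k) ⟩
  ⌜ n C suc k ⌝ + ⌜ n C k ⌝          ≡⟨ +-comm ⌜ n C suc k ⌝ ⌜ n C k ⌝ ⟩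
  ⌜ n C k ⌝ + ⌜ n C suc k ⌝          ≡⟨ sym (⌜⌝-homo-+ (n C k) (n C suc k)) ⟩
  ⌜ n C k ℕ.+ n C suc k ⌝            ≡⟨ cong ⌜_⌝ (nCk+nC[k+1]≡[n+1]C[k+1] n k) ⟩
  ⌜ suc n C suc k ⌝                  ∎

[k+1]nC[k+1]≡[n-k]nCk : ∀ n k → ⌜ suc k ⌝ * ⌜ n C suc k ⌝ ≡ (⌜ n ⌝ - ⌜ k ⌝) * ⌜ n C k ⌝
[k+1]nC[k+1]≡[n-k]nCk n k = begin
  ⌜ suc k ⌝ * b
    ≡⟨ solve 3 (λ s a b → s :* b := s :* (a :+ b) :- s :* a) refl ⌜ suc k ⌝ a b ⟩
  ⌜ suc k ⌝ * (a + b) - ⌜ suc k ⌝ * a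
    ≡⟨ cong (λ z → ⌜ suc k ⌝ * z - ⌜ suc k ⌝ * a) (sym (⌜⌝-homo-+ (n C k) (n C suc k))) ⟩
  ⌜ suc k ⌝ * ⌜ n C k ℕ.+ n C suc k ⌝ - ⌜ suc k ⌝ * a
    ≡⟨ cong (λ z → ⌜ suc k ⌝ * ⌜ z ⌝ - ⌜ suc k ⌝ * a) (nCk+nC[k+1]≡[n+1]C[k+1] n k) ⟩
  ⌜ suc k ⌝ * ⌜ suc n C suc k ⌝ - ⌜ suc k ⌝ * a
    ≡⟨ cong (_- ⌜ suc k ⌝ * a) absorption ⟩
  ⌜ suc n ⌝ * a - ⌜ suc k ⌝ * a
    ≡⟨ solve 3 (λ n k a → (con 1ℚ :+ n) :* a :- (con 1ℚ :+ k) :* a := (n :- k) :* a) refl ⌜ n ⌝ ⌜ k ⌝ a ⟩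
  (⌜ n ⌝ - ⌜ k ⌝) * a ∎
  where
  a = ⌜ n C k ⌝
  b = ⌜ n C suc k ⌝
  absorption : ⌜ suc k ⌝ * ⌜ suc n C suc k ⌝ ≡ ⌜ suc n ⌝ * a
  absorption = trans (sym (⌜⌝-homo-* (suc k) (suc n C suc k)))
                     (trans (cong ⌜_⌝ ([k+1][n+1]C[k+1]≡[n+1]nCk n k)) (⌜⌝-homo-* (suc n) (n C k)))

nC[k+1]≡[n-k]nCk/[k+1] : ∀ n k → ⌜ n C suc k ⌝ ≡ (⌜ n ⌝ - ⌜ k ⌝) * ⌜ n C k ⌝ * inv (suc k)
nC[k+1]≡[n-k]nCk/[k+1] n k = ⌜⌝*x≡y⇒x≡y*inv {suc k} _ _ (s≤s z≤n) ([k+1]nC[k+1]≡[n-k]nCk n k)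

1/nCk≡[n-k]/[k+1]nC[k+1] : ∀ {n k} → k < n → inv (n C k) ≡ (⌜ n ⌝ - ⌜ k ⌝) * inv (suc k) * inv (n C suc k)
1/nCk≡[n-k]/[k+1]nC[k+1] {n} {k} k<n = begin
  q                                  ≡⟨ sym (*-identityʳ q) ⟩
  q * 1ℚ                             ≡⟨ cong (q *_) (sym (⌜⌝*inv≡1 (0<nCk k<n))) ⟩
  q * (⌜ n C suc k ⌝ * r)            ≡⟨ cong (λ e → q * (e * r)) (nC[k+1]≡[n-k]nCk/[k+1] n k) ⟩
  q * ((n-k) * d * p * r)            ≡⟨ solve 5 (λ q m d p r → q :* (m :* d :* p :* r) := m :* p :* r :* (d :* q)) refl q n-k d p r ⟩
  n-k * p * r * (d * q)              ≡⟨ cong (n-k * p * r *_) (⌜⌝*inv≡1 (0<nCk (ℕ.<⇒≤ k<n))) ⟩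
  n-k * p * r * 1ℚ                   ≡⟨ *-identityʳ _ ⟩
  n-k * p * r                        ∎
  where
  n-k = ⌜ n ⌝ - ⌜ k ⌝
  d = ⌜ n C k ⌝
  p = inv (suc k)
  q = inv (n C k)
  r = inv (n C suc k)

-- The connecting kernel

module Kernel (M : ℕ) where

  K : ℕ → ℕ → ℚ
  K u v = ⌜ u C v ⌝ * (inv (suc v) * inv (M C suc v))

  K-column-partial-sum : ∀ n v → Σ< n (λ u → K u v) ≡ ⌜ n C suc v ⌝ * (inv (suc v) * inv (M C suc v))
  K-column-partial-sum n v =
    trans (sym (*-distribʳ-Σ< n _ (λ u → ⌜ u C v ⌝))) (cong (_* (inv (suc v) * inv (M C suc v))) (hockey-stick n v))

  K-column-sum : ∀ v → v < M → Σ< M (λ u → K u v) ≡ inv (suc v)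
  K-column-sum v v<M = begin
    Σ< M (λ u → K u v)                              ≡⟨ K-column-partial-sum M v ⟩
    ⌜ M C suc v ⌝ * (inv (suc v) * inv (M C suc v)) ≡⟨ solve 3 (λ e p r → e :* (p :* r) := p :* (e :* r)) refl
                                                               ⌜ M C suc v ⌝ (inv (suc v)) (inv (M C suc v)) ⟩
    inv (suc v) * (⌜ M C suc v ⌝ * inv (M C suc v)) ≡⟨ cong (inv (suc v) *_) (⌜⌝*inv≡1 (0<nCk v<M)) ⟩
    inv (suc v) * 1ℚ                                ≡⟨ *-identityʳ (inv (suc v)) ⟩
    inv (suc v)                                     ∎

  K-column-prefix-sum : ∀ n v → n < M → Σ< M (λ u → K u v when (u ≤ᵇ n)) ≡ ⌜ suc n ⌝ * inv (suc v) * K n v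
  K-column-prefix-sum n v n<M = begin
    Σ< M (λ u → K u v when (u ≤ᵇ n))               ≡⟨ Σ<-when-≤ᵇ M n (λ u → K u v) n<M ⟩
    Σ< (suc n) (λ u → K u v)                        ≡⟨ K-column-partial-sum (suc n) v ⟩
    ⌜ suc n C suc v ⌝ * c                           ≡⟨ cong (_* c) (⌜⌝*x≡y⇒x≡y*inv {suc v} _ _ (s≤s z≤n) absorption) ⟩
    (⌜ suc n ⌝ * ⌜ n C v ⌝) * inv (suc v) * c       ≡⟨ solve 4 (λ a b d e → a :* b :* d :* e := a :* d :* (b :* e)) refl
                                                               ⌜ suc n ⌝ ⌜ n C v ⌝ (inv (suc v)) c ⟩
    ⌜ suc n ⌝ * inv (suc v) * K n v                 ∎
    where
    c = inv (suc v) * inv (M C suc v)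
    absorption : ⌜ suc v ⌝ * ⌜ suc n C suc v ⌝ ≡ ⌜ suc n ⌝ * ⌜ n C v ⌝
    absorption = trans (sym (⌜⌝-homo-* (suc v) (suc n C suc v)))
                       (trans (cong ⌜_⌝ ([k+1][n+1]C[k+1]≡[n+1]nCk n v)) (⌜⌝-homo-* (suc n) (n C v)))

  K-column-suffix-sum : ∀ w v → w ≤ M →
    Σ< M (λ u → K u v when (w ≤ᵇ u)) ≡ (⌜ M C suc v ⌝ - ⌜ w C suc v ⌝) * (inv (suc v) * inv (M C suc v))
  K-column-suffix-sum w v w≤M = begin
    S                                                   ≡⟨ solve 2 (λ s a → s := (s :+ a) :- a) refl S (Σ< w (λ u → K u v)) ⟩
    (S + Σ< w (λ u → K u v)) - Σ< w (λ u → K u v)       ≡⟨ cong (_- Σ< w (λ u → K u v)) (Σ<-when-≥ᵇ M w (λ u → K u v) w≤M) ⟩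
    Σ< M (λ u → K u v) - Σ< w (λ u → K u v)             ≡⟨ cong₂ _-_ (K-column-partial-sum M v) (K-column-partial-sum w v) ⟩
    ⌜ M C suc v ⌝ * c - ⌜ w C suc v ⌝ * c               ≡⟨ solve 3 (λ a b c → a :* c :- b :* c := (a :- b) :* c) refl
                                                                   ⌜ M C suc v ⌝ ⌜ w C suc v ⌝ c ⟩
    (⌜ M C suc v ⌝ - ⌜ w C suc v ⌝) * c                 ∎
    where
    S = Σ< M (λ u → K u v when (w ≤ᵇ u))
    c = inv (suc v) * inv (M C suc v)

  K-row-partial-sum : ∀ w t → w < M → t ≤ M → Σ< t (K w) ≡ inv (M ∸ w) * (1ℚ - ⌜ w C t ⌝ * inv (M C t))
  K-row-partial-sum w zero    w<M _   = sym (*-zeroʳ (inv (M ∸ w)))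
  K-row-partial-sum w (suc t) w<M t<M = begin
    Σ< t (K w) + K w t
      ≡⟨ cong (_+ K w t) (K-row-partial-sum w t w<M (ℕ.<⇒≤ t<M)) ⟩
    i * (1ℚ - c * inv (M C t)) + c * (p * r)
      ≡⟨ cong (λ z → i * (1ℚ - c * z) + c * (p * r)) (1/nCk≡[n-k]/[k+1]nC[k+1] t<M) ⟩
    i * (1ℚ - c * ((⌜ M ⌝ - ⌜ t ⌝) * p * r)) + c * (p * r)
      ≡⟨ solve 7 (λ i c p r m t w → i :* (con 1ℚ :- c :* ((m :- t) :* p :* r)) :+ c :* (p :* r)
                    := i :* (con 1ℚ :- (w :- t) :* c :* p :* r) :+ c :* p :* r :* (con 1ℚ :- i :* (m :- w)))
                 refl i c p r ⌜ M ⌝ ⌜ t ⌝ ⌜ w ⌝ ⟩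
    i * (1ℚ - (⌜ w ⌝ - ⌜ t ⌝) * c * p * r) + c * p * r * (1ℚ - i * (⌜ M ⌝ - ⌜ w ⌝))
      ≡⟨ cong₂ (λ x y → i * (1ℚ - x * r) + c * p * r * (1ℚ - y)) (sym (nC[k+1]≡[n-k]nCk/[k+1] w t)) i[M-w]≡1 ⟩
    i * (1ℚ - ⌜ w C suc t ⌝ * r) + c * p * r * (1ℚ - 1ℚ)
      ≡⟨ solve 5 (λ i b r c p → i :* (con 1ℚ :- b :* r) :+ c :* p :* r :* (con 1ℚ :- con 1ℚ) := i :* (con 1ℚ :- b :* r))
                 refl i ⌜ w C suc t ⌝ r c p ⟩
    i * (1ℚ - ⌜ w C suc t ⌝ * r) ∎
    where
    i = inv (M ∸ w)
    c = ⌜ w C t ⌝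
    p = inv (suc t)
    r = inv (M C suc t)
    i[M-w]≡1 : i * (⌜ M ⌝ - ⌜ w ⌝) ≡ 1ℚ
    i[M-w]≡1 = trans (cong (i *_) (sym (⌜⌝-homo-∸ (ℕ.<⇒≤ w<M)))) (trans (*-comm i _) (⌜⌝*inv≡1 (ℕ.m<n⇒0<n∸m w<M)))

  K-row-sum : ∀ w → w < M → Σ< M (K w) ≡ inv (M ∸ w)
  K-row-sum w w<M = begin
    Σ< M (K w)                                 ≡⟨ K-row-partial-sum w M w<M ℕ.≤-refl ⟩
    inv (M ∸ w) * (1ℚ - ⌜ w C M ⌝ * inv (M C M)) ≡⟨ cong (λ z → inv (M ∸ w) * (1ℚ - ⌜ z ⌝ * inv (M C M))) (k>n⇒nCk≡0 w<M) ⟩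
    inv (M ∸ w) * (1ℚ - 0ℚ * inv (M C M))        ≡⟨ solve 2 (λ i x → i :* (con 1ℚ :- con 0ℚ :* x) := i) refl (inv (M ∸ w)) (inv (M C M)) ⟩
    inv (M ∸ w)                                ∎

  K-row-prefix-sum : ∀ w v → w < M → v < M →
    Σ< M (λ x → K w x when (x ≤ᵇ v)) ≡ inv (M ∸ w) * ⌜ suc v ⌝ * Σ< M (λ u → K u v when (w ≤ᵇ u))
  K-row-prefix-sum w v w<M v<M = begin
    Σ< M (λ x → K w x when (x ≤ᵇ v))         ≡⟨ Σ<-when-≤ᵇ M v (K w) v<M ⟩
    Σ< (suc v) (K w)                         ≡⟨ K-row-partial-sum w (suc v) w<M v<M ⟩
    i * (1ℚ - b * r)                         ≡⟨ sym (*-identityʳ _) ⟩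
    i * (1ℚ - b * r) * 1ℚ                    ≡⟨ cong₂ (λ x y → i * (x - b * r) * y) (sym er≡1) (sym Tp≡1) ⟩
    i * (e * r - b * r) * (T * p)            ≡⟨ solve 6 (λ i e r b T p → i :* (e :* r :- b :* r) :* (T :* p) := i :* T :* ((e :- b) :* (p :* r)))
                                                        refl i e r b T p ⟩
    i * T * ((e - b) * (p * r))              ≡⟨ cong (i * T *_) (sym (K-column-suffix-sum w v (ℕ.<⇒≤ w<M))) ⟩
    i * T * Σ< M (λ u → K u v when (w ≤ᵇ u)) ∎
    where
    i = inv (M ∸ w)
    b = ⌜ w C suc v ⌝
    e = ⌜ M C suc v ⌝
    p = inv (suc v)
    r = inv (M C suc v)
    T = ⌜ suc v ⌝
    Tp≡1 : T * p ≡ 1ℚ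
    Tp≡1 = ⌜⌝*inv≡1 {suc v} (s≤s z≤n)
    er≡1 : e * r ≡ 1ℚ
    er≡1 = ⌜⌝*inv≡1 (0<nCk v<M)

sumℚ-cong : ∀ {A : Set} {f g : A → ℚ} xs → (∀ x → f x ≡ g x) → sumℚ (map f xs) ≡ sumℚ (map g xs)
sumℚ-cong xs eq = cong sumℚ (List.map-cong eq xs)

sumℚ-++ : ∀ (xs ys : List ℚ) → sumℚ (xs ++ ys) ≡ sumℚ xs + sumℚ ys
sumℚ-++ []       ys = sym (+-identityˡ _)
sumℚ-++ (x ∷ xs) ys = trans (cong (x +_) (sumℚ-++ xs ys)) (sym (+-assoc x (sumℚ xs) (sumℚ ys)))

sumℚ-filterᵇ : ∀ {A : Set} (p : A → Bool) (g : A → ℚ) xs → sumℚ (map g (filterᵇ p xs)) ≡ sumℚ (map (λ x → g x when p x) xs)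
sumℚ-filterᵇ p g []       = refl
sumℚ-filterᵇ p g (x ∷ xs) with p x
... | true  = cong (g x +_) (sumℚ-filterᵇ p g xs)
... | false = trans (sumℚ-filterᵇ p g xs) (sym (+-identityˡ _))

sumℚ-*-when : ∀ {A : Set} b c (f : A → ℚ) xs → sumℚ (map (λ x → c * f x when b) xs) ≡ c * sumℚ (map f xs) when b
sumℚ-*-when true  c f []       = sym (*-zeroʳ c)
sumℚ-*-when true  c f (x ∷ xs) = trans (cong (c * f x +_) (sumℚ-*-when true c f xs)) (sym (*-distribˡ-+ c (f x) _))
sumℚ-*-when false c f []       = refl
sumℚ-*-when false c f (x ∷ xs) = trans (+-identityˡ _) (sumℚ-*-when false c f xs)

sumℚ-concatMap : ∀ {A B : Set} (g : B → ℚ) (h : A → List B) xs →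
  sumℚ (map g (concatMap h xs)) ≡ sumℚ (map (λ x → sumℚ (map g (h x))) xs)
sumℚ-concatMap g h []       = refl
sumℚ-concatMap g h (x ∷ xs) = begin
  sumℚ (map g (h x ++ concatMap h xs))                   ≡⟨ cong sumℚ (List.map-++ g (h x) (concatMap h xs)) ⟩
  sumℚ (map g (h x) ++ map g (concatMap h xs))           ≡⟨ sumℚ-++ (map g (h x)) _ ⟩
  sumℚ (map g (h x)) + sumℚ (map g (concatMap h xs))     ≡⟨ cong (sumℚ (map g (h x)) +_) (sumℚ-concatMap g h xs) ⟩
  sumℚ (map g (h x)) + sumℚ (map (λ x → sumℚ (map g (h x))) xs) ∎

sumℚ-tuples-suc : ∀ {A : Set} (R : List A) m (g : List A → ℚ) →
  sumℚ (map g (tuples R (suc m))) ≡ sumℚ (map (λ x → sumℚ (map (λ xs → g (x ∷ xs)) (tuples R m))) R)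
sumℚ-tuples-suc R m g = trans (sumℚ-concatMap g (λ x → map (x ∷_) (tuples R m)) R)
                              (sumℚ-cong R (λ x → cong sumℚ (sym (List.map-∘ (tuples R m)))))

sumℚ-shaped-∷ : ∀ {A : Set} (R : List A) k ks (g : List (List A) → ℚ) →
  sumℚ (map g (shaped R (k ∷ ks))) ≡ sumℚ (map (λ row → sumℚ (map (λ rows → g (row ∷ rows)) (shaped R ks))) (tuples R k))
sumℚ-shaped-∷ R k ks g = trans (sumℚ-concatMap g (λ row → map (row ∷_) (shaped R ks)) (tuples R k))
                               (sumℚ-cong (tuples R k) (λ row → cong sumℚ (sym (List.map-∘ (shaped R ks)))))

sumℚ-applyUpTo : ∀ n (g : ℕ → ℕ) (f : ℕ → ℚ) → sumℚ (map f (applyUpTo g n)) ≡ Σ< n (f ∘ g)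
sumℚ-applyUpTo zero    g f = refl
sumℚ-applyUpTo (suc n) g f = trans (cong (f (g 0) +_) (sumℚ-applyUpTo n (g ∘ suc) f)) (sym (Σ<-sucˡ n (f ∘ g)))

sumℚ-upTo : ∀ n (f : ℕ → ℚ) → sumℚ (map f (upTo n)) ≡ Σ< n f
sumℚ-upTo n = sumℚ-applyUpTo n (λ i → i)

when-interchange : ∀ a b c d u v → u * v when ((a ∧ b) ∧ (c ∧ d)) ≡ u * (v when (b ∧ d)) when (a ∧ c)
when-interchange a b c d u v = trans (cong (u * v when_) (∧-interchange a b c d)) (when-split (a ∧ c) (b ∧ d) u v)

-- Truncated sums and their first-entry recursions

module Truncated (M : ℕ) where

  inRange : ℕ → Bool
  inRange x = (0 <ᵇ x) ∧ (x <ᵇ suc M)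

  sumℚ-cand : ∀ (f : ℕ → ℚ) → sumℚ (map (λ x → f x when inRange x) (cand (suc M))) ≡ Σ< M (f ∘ suc)
  sumℚ-cand f = begin
    sumℚ (map g (cand (suc M)))                     ≡⟨ sumℚ-upTo (suc (suc M)) g ⟩
    Σ< (suc M) g + f (suc M) when inRange (suc M)   ≡⟨ cong (λ b → Σ< (suc M) g + f (suc M) when (true ∧ b)) (<ᵇ-irrefl M) ⟩
    Σ< (suc M) g + 0ℚ                               ≡⟨ +-identityʳ _ ⟩
    Σ< (suc M) g                                    ≡⟨ Σ<-sucˡ M g ⟩
    0ℚ + Σ< M (g ∘ suc)                             ≡⟨ +-identityˡ _ ⟩
    Σ< M (g ∘ suc)                                  ≡⟨ Σ<-cong-< M (λ j j<M → cong (f (suc j) when_) (<ᵇ-true j<M)) ⟩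
    Σ< M (f ∘ suc)                                  ∎
    where
    g = λ x → f x when inRange x

  zetaStar≥ : ℕ → List ℕ → ℚ
  zetaStar≥ lo ks = sumℚ (map (λ ms → prodℚ (zipProd ms ks) when (allPosBelow (suc M) ms ∧ nondecr (lo ∷ ms)))
                              (tuples (cand (suc M)) (length ks)))

  -- The link with a virtual row (y) imposes y ≤ n_{1k₁}.
  zetaStarFlat≥ : ℕ → List ℕ → ℚ
  zetaStarFlat≥ y ks = sumℚ (map (λ rows → prodℚ (map (rowTerm (suc M)) rows)
                                             when (and (map (rowOK (suc M)) rows) ∧ linked ((y ∷ []) ∷ rows)))
                                  (shaped (cand (suc M)) ks))

  -- The entries n₂ ≤ ⋯ ≤ n_k of a row with first entry lo, under the link condition y ≤ n_k.
  rowTail : ℕ → ℕ → ℕ → ℚ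
  rowTail m lo y = sumℚ (map (λ ns → prodℚ (map inv ns)
                                       when (allPosBelow (suc M) ns ∧ (nondecr (lo ∷ ns) ∧ (y ≤ᵇ lastE (lo ∷ ns)))))
                              (tuples (cand (suc M)) m))

  zetaStar≡zetaStar≥0 : ∀ ks → zetaStar (suc M) ks ≡ zetaStar≥ 0 ks
  zetaStar≡zetaStar≥0 ks = trans (sumℚ-filterᵇ _ _ (tuples (cand (suc M)) (length ks)))
    (sumℚ-cong (tuples (cand (suc M)) (length ks)) (λ ms → cong (λ b → prodℚ (zipProd ms ks) when (allPosBelow (suc M) ms ∧ b)) (nondecr-0∷ ms)))
    where
    nondecr-0∷ : ∀ ms → nondecr ms ≡ nondecr (0 ∷ ms)
    nondecr-0∷ []      = refl
    nondecr-0∷ (_ ∷ _) = refl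

  zetaStarFlat≡zetaStarFlat≥0 : ∀ ks → zetaStarFlat (suc M) ks ≡ zetaStarFlat≥ 0 ks
  zetaStarFlat≡zetaStarFlat≥0 ks = trans (sumℚ-filterᵇ _ _ (shaped (cand (suc M)) ks))
    (sumℚ-cong (shaped (cand (suc M)) ks) (λ rows → cong (λ b → prodℚ (map (rowTerm (suc M)) rows) when (and (map (rowOK (suc M)) rows) ∧ b)) (linked-0∷ rows)))
    where
    linked-0∷ : ∀ rows → linked rows ≡ linked ((0 ∷ []) ∷ rows)
    linked-0∷ []      = refl
    linked-0∷ (_ ∷ _) = refl

  zetaStar≥-∷ : ∀ lo k ks → zetaStar≥ lo (k ∷ ks) ≡ Σ< M (λ j → invPow (suc j) k * zetaStar≥ (suc j) ks when (lo ≤ᵇ suc j))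
  zetaStar≥-∷ lo k ks = begin
    zetaStar≥ lo (k ∷ ks)                                                             ≡⟨ sumℚ-tuples-suc Cs (length ks) G ⟩
    sumℚ (map (λ x → sumℚ (map (λ ms → G (x ∷ ms)) Ts)) Cs)                           ≡⟨ sumℚ-cong Cs peel ⟩
    sumℚ (map (λ x → (invPow x k * zetaStar≥ x ks when (lo ≤ᵇ x)) when inRange x) Cs) ≡⟨ sumℚ-cand _ ⟩
    Σ< M (λ j → invPow (suc j) k * zetaStar≥ (suc j) ks when (lo ≤ᵇ suc j))           ∎
    where
    Cs = cand (suc M)
    Ts = tuples Cs (length ks)
    G : List ℕ → ℚ
    G ms = prodℚ (zipProd ms (k ∷ ks)) when (allPosBelow (suc M) ms ∧ nondecr (lo ∷ ms))
    peel : ∀ x → sumℚ (map (λ ms → G (x ∷ ms)) Ts) ≡ (invPow x k * zetaStar≥ x ks when (lo ≤ᵇ x)) when inRange x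
    peel x = begin
      sumℚ (map (λ ms → G (x ∷ ms)) Ts)
        ≡⟨ sumℚ-cong Ts (λ ms → when-interchange (inRange x) _ (lo ≤ᵇ x) _ (invPow x k) _) ⟩
      sumℚ (map (λ ms → invPow x k * H ms when (inRange x ∧ (lo ≤ᵇ x))) Ts)
        ≡⟨ sumℚ-*-when (inRange x ∧ (lo ≤ᵇ x)) (invPow x k) H Ts ⟩
      invPow x k * zetaStar≥ x ks when (inRange x ∧ (lo ≤ᵇ x))
        ≡⟨ when-∧ (inRange x) (lo ≤ᵇ x) _ ⟩
      (invPow x k * zetaStar≥ x ks when (lo ≤ᵇ x)) when inRange x ∎
      where
      H : List ℕ → ℚ
      H ms = prodℚ (zipProd ms ks) when (allPosBelow (suc M) ms ∧ nondecr (x ∷ ms))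

  rowTail-zero : ∀ lo y → rowTail 0 lo y ≡ 1ℚ when (y ≤ᵇ lo)
  rowTail-zero lo y = +-identityʳ _

  rowTail-suc : ∀ m u y → rowTail (suc m) (suc u) y ≡ Σ< M (λ j → inv (suc j) * rowTail m (suc j) y when (u ≤ᵇ j))
  rowTail-suc m u y = begin
    rowTail (suc m) lo y                                                        ≡⟨ sumℚ-tuples-suc Cs m G ⟩
    sumℚ (map (λ x → sumℚ (map (λ ns → G (x ∷ ns)) Ts)) Cs)                     ≡⟨ sumℚ-cong Cs peel ⟩
    sumℚ (map (λ x → (inv x * rowTail m x y when (lo ≤ᵇ x)) when inRange x) Cs) ≡⟨ sumℚ-cand _ ⟩
    Σ< M (λ j → inv (suc j) * rowTail m (suc j) y when (suc u ≤ᵇ suc j))        ≡⟨ Σ<-cong M (λ j → cong (_ when_) (≤ᵇ-suc u j)) ⟩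
    Σ< M (λ j → inv (suc j) * rowTail m (suc j) y when (u ≤ᵇ j))                ∎
    where
    lo = suc u
    Cs = cand (suc M)
    Ts = tuples Cs m
    G : List ℕ → ℚ
    G ns = prodℚ (map inv ns) when (allPosBelow (suc M) ns ∧ (nondecr (lo ∷ ns) ∧ (y ≤ᵇ lastE (lo ∷ ns))))
    peel : ∀ x → sumℚ (map (λ ns → G (x ∷ ns)) Ts) ≡ (inv x * rowTail m x y when (lo ≤ᵇ x)) when inRange x
    peel x = begin
      sumℚ (map (λ ns → G (x ∷ ns)) Ts)
        ≡⟨ sumℚ-cong Ts (λ ns → trans (cong (inv x * prodℚ (map inv ns) when_)
                                             (cong ((inRange x ∧ allPosBelow (suc M) ns) ∧_) (∧-assoc (lo ≤ᵇ x) _ _)))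
                                       (when-interchange (inRange x) _ (lo ≤ᵇ x) _ (inv x) _)) ⟩
      sumℚ (map (λ ns → inv x * H ns when (inRange x ∧ (lo ≤ᵇ x))) Ts)
        ≡⟨ sumℚ-*-when (inRange x ∧ (lo ≤ᵇ x)) (inv x) H Ts ⟩
      inv x * rowTail m x y when (inRange x ∧ (lo ≤ᵇ x))
        ≡⟨ when-∧ (inRange x) (lo ≤ᵇ x) _ ⟩
      (inv x * rowTail m x y when (lo ≤ᵇ x)) when inRange x ∎
      where
      H : List ℕ → ℚ
      H ns = prodℚ (map inv ns) when (allPosBelow (suc M) ns ∧ (nondecr (x ∷ ns) ∧ (y ≤ᵇ lastE (x ∷ ns))))

  zetaStarFlat≥-[] : ∀ y → zetaStarFlat≥ y [] ≡ 1ℚ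
  zetaStarFlat≥-[] y = +-identityʳ 1ℚ

  zetaStar≥-[] : ∀ lo → zetaStar≥ lo [] ≡ 1ℚ
  zetaStar≥-[] lo = +-identityʳ 1ℚ

  zetaStarFlat≥-first-row : ∀ y k ks → zetaStarFlat≥ y (k ∷ ks) ≡
    sumℚ (map (λ row → rowTerm (suc M) row * zetaStarFlat≥ (firstE row) ks when (rowOK (suc M) row ∧ (y ≤ᵇ lastE row)))
              (tuples (cand (suc M)) k))
  zetaStarFlat≥-first-row y k ks = trans (sumℚ-shaped-∷ Cs k ks G) (sumℚ-cong (tuples Cs k) peel)
    where
    Cs = cand (suc M)
    G : List (List ℕ) → ℚ
    G rows = prodℚ (map (rowTerm (suc M)) rows) when (and (map (rowOK (suc M)) rows) ∧ linked ((y ∷ []) ∷ rows))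
    linked-∷ : ∀ row rows → linked (row ∷ rows) ≡ linked ((firstE row ∷ []) ∷ rows)
    linked-∷ row []      = refl
    linked-∷ row (_ ∷ _) = refl
    peel : ∀ row → sumℚ (map (λ rows → G (row ∷ rows)) (shaped Cs ks))
                   ≡ rowTerm (suc M) row * zetaStarFlat≥ (firstE row) ks when (rowOK (suc M) row ∧ (y ≤ᵇ lastE row))
    peel row = begin
      sumℚ (map (λ rows → G (row ∷ rows)) (shaped Cs ks))
        ≡⟨ sumℚ-cong (shaped Cs ks) (λ rows → trans (cong (λ b → t * prodℚ (map (rowTerm (suc M)) rows) when (ok rows ∧ (y≤ ∧ b)))
                                                          (linked-∷ row rows))
                                                    (when-interchange (rowOK (suc M) row) _ y≤ _ t _)) ⟩
      sumℚ (map (λ rows → t * H rows when (rowOK (suc M) row ∧ y≤)) (shaped Cs ks))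
        ≡⟨ sumℚ-*-when (rowOK (suc M) row ∧ y≤) t H (shaped Cs ks) ⟩
      t * zetaStarFlat≥ (firstE row) ks when (rowOK (suc M) row ∧ y≤) ∎
      where
      t = rowTerm (suc M) row
      y≤ = y ≤ᵇ lastE row
      ok = λ rows → rowOK (suc M) row ∧ and (map (rowOK (suc M)) rows)
      H : List (List ℕ) → ℚ
      H rows = prodℚ (map (rowTerm (suc M)) rows) when (and (map (rowOK (suc M)) rows) ∧ linked ((firstE row ∷ []) ∷ rows))

  zetaStarFlat≥-∷ : ∀ y k ks →
    zetaStarFlat≥ y (suc k ∷ ks) ≡ Σ< M (λ u → inv (M ∸ u) * zetaStarFlat≥ (suc u) ks * rowTail k (suc u) y)
  zetaStarFlat≥-∷ y k ks = begin
    zetaStarFlat≥ y (suc k ∷ ks)                                            ≡⟨ zetaStarFlat≥-first-row y (suc k) ks ⟩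
    sumℚ (map F (tuples Cs (suc k)))                                         ≡⟨ sumℚ-tuples-suc Cs k F ⟩
    sumℚ (map (λ a → sumℚ (map (λ ns → F (a ∷ ns)) Ts)) Cs)                  ≡⟨ sumℚ-cong Cs peel ⟩
    sumℚ (map (λ a → inv (suc M ∸ a) * Z a * rowTail k a y when inRange a) Cs) ≡⟨ sumℚ-cand _ ⟩
    Σ< M (λ u → inv (M ∸ u) * Z (suc u) * rowTail k (suc u) y)              ∎
    where
    Cs = cand (suc M)
    Ts = tuples Cs k
    Z = λ a → zetaStarFlat≥ a ks
    F : List ℕ → ℚ
    F row = rowTerm (suc M) row * Z (firstE row) when (rowOK (suc M) row ∧ (y ≤ᵇ lastE row))
    peel : ∀ a → sumℚ (map (λ ns → F (a ∷ ns)) Ts) ≡ inv (suc M ∸ a) * Z a * rowTail k a y when inRange a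
    peel a = trans (sumℚ-cong Ts reorder) (sumℚ-*-when (inRange a) (inv (suc M ∸ a) * Z a) _ Ts)
      where
      reorder : ∀ ns → F (a ∷ ns) ≡ inv (suc M ∸ a) * Z a
                                    * (prodℚ (map inv ns) when (allPosBelow (suc M) ns ∧ (nondecr (a ∷ ns) ∧ (y ≤ᵇ lastE (a ∷ ns)))))
                                    when inRange a
      reorder ns = begin
        (i * p) * Z a when (((inRange a ∧ b) ∧ c) ∧ d) ≡⟨ cong ((i * p) * Z a when_) (trans (∧-assoc (inRange a ∧ b) c d) (∧-assoc (inRange a) b (c ∧ d))) ⟩
        (i * p) * Z a when (inRange a ∧ (b ∧ (c ∧ d))) ≡⟨ cong (_when (inRange a ∧ (b ∧ (c ∧ d))))
                                                              (solve 3 (λ i p z → (i :* p) :* z := (i :* z) :* p) refl i p (Z a)) ⟩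
        (i * Z a) * p when (inRange a ∧ (b ∧ (c ∧ d))) ≡⟨ when-split (inRange a) (b ∧ (c ∧ d)) (i * Z a) p ⟩
        i * Z a * (p when (b ∧ (c ∧ d))) when inRange a ∎
        where
        i = inv (suc M ∸ a)
        p = prodℚ (map inv ns)
        b = allPosBelow (suc M) ns
        c = nondecr (a ∷ ns)
        d = y ≤ᵇ lastE (a ∷ ns)

-- The connector identity

module Connector (M : ℕ) where
  open Kernel M
  open Truncated M

  columnSum≥ : ℕ → ℕ → ℚ
  columnSum≥ y v = Σ< M (λ u → K u v when (y ≤ᵇ suc u))

  columnSum≥-suc : ∀ w v → columnSum≥ (suc w) v ≡ Σ< M (λ u → K u v when (w ≤ᵇ u))
  columnSum≥-suc w v = Σ<-cong M (λ u → cong (K u v when_) (≤ᵇ-suc w u))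

  K-rowTail : ∀ m y v → Σ< M (λ u → K u v * rowTail m (suc u) y) ≡ invPow (suc v) m * columnSum≥ y v
  K-rowTail zero y v = begin
    Σ< M (λ u → K u v * rowTail 0 (suc u) y) ≡⟨ Σ<-cong M (λ u → trans (cong (K u v *_) (rowTail-zero (suc u) y))
                                                                     (trans (*-when (y ≤ᵇ suc u) (K u v) 1ℚ)
                                                                            (cong (_when (y ≤ᵇ suc u)) (*-identityʳ (K u v))))) ⟩
    columnSum≥ y v                           ≡⟨ sym (*-identityˡ _) ⟩
    1ℚ * columnSum≥ y v                      ∎
  K-rowTail (suc m) y v = begin
    Σ< M (λ u → K u v * rowTail (suc m) (suc u) y)
      ≡⟨ Σ<-cong M (λ u → cong (K u v *_) (rowTail-suc m u y)) ⟩
    Σ< M (λ u → K u v * Σ< M (λ j → inv (suc j) * R j when (u ≤ᵇ j)))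
      ≡⟨ Σ<-triangle M (λ u → K u v) (λ j → inv (suc j) * R j) ⟩
    Σ< M (λ j → Σ< M (λ u → K u v when (u ≤ᵇ j)) * (inv (suc j) * R j))
      ≡⟨ Σ<-cong-< M (λ j j<M → cong (_* (inv (suc j) * R j)) (K-column-prefix-sum j v j<M)) ⟩
    Σ< M (λ j → (⌜ suc j ⌝ * inv (suc v) * K j v) * (inv (suc j) * R j))
      ≡⟨ Σ<-cong M cancel ⟩
    Σ< M (λ j → inv (suc v) * (K j v * R j))
      ≡⟨ sym (*-distribˡ-Σ< M (inv (suc v)) _) ⟩
    inv (suc v) * Σ< M (λ j → K j v * R j)
      ≡⟨ cong (inv (suc v) *_) (K-rowTail m y v) ⟩
    inv (suc v) * (invPow (suc v) m * columnSum≥ y v)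
      ≡⟨ sym (*-assoc (inv (suc v)) _ _) ⟩
    invPow (suc v) (suc m) * columnSum≥ y v ∎
    where
    R : ℕ → ℚ
    R j = rowTail m (suc j) y
    cancel : ∀ j → (⌜ suc j ⌝ * inv (suc v) * K j v) * (inv (suc j) * R j) ≡ inv (suc v) * (K j v * R j)
    cancel j = begin
      (⌜ suc j ⌝ * inv (suc v) * K j v) * (inv (suc j) * R j)
        ≡⟨ solve 5 (λ a b c d e → (a :* b :* c) :* (d :* e) := (a :* d) :* (b :* (c :* e))) refl
                   ⌜ suc j ⌝ (inv (suc v)) (K j v) (inv (suc j)) (R j) ⟩
      (⌜ suc j ⌝ * inv (suc j)) * (inv (suc v) * (K j v * R j))
        ≡⟨ cong (_* (inv (suc v) * (K j v * R j))) (⌜⌝*inv≡1 {suc j} (s≤s z≤n)) ⟩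
      1ℚ * (inv (suc v) * (K j v * R j))
        ≡⟨ *-identityˡ _ ⟩
      inv (suc v) * (K j v * R j) ∎

  Connected : List ℕ → Set
  Connected ks = ∀ w → w < M → inv (M ∸ w) * zetaStarFlat≥ (suc w) ks ≡ Σ< M (λ v → K w v * zetaStar≥ (suc v) ks)

  zetaStarFlat≥-∷-via-K : ∀ k ks → Connected ks → ∀ y →
    zetaStarFlat≥ y (suc k ∷ ks) ≡ Σ< M (λ v → zetaStar≥ (suc v) ks * (invPow (suc v) k * columnSum≥ y v))
  zetaStarFlat≥-∷-via-K k ks connected y = begin
    zetaStarFlat≥ y (suc k ∷ ks)
      ≡⟨ zetaStarFlat≥-∷ y k ks ⟩
    Σ< M (λ u → inv (M ∸ u) * zetaStarFlat≥ (suc u) ks * rowTail k (suc u) y)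
      ≡⟨ Σ<-cong-< M (λ u u<M → cong (_* rowTail k (suc u) y) (connected u u<M)) ⟩
    Σ< M (λ u → Σ< M (λ v → K u v * A v) * rowTail k (suc u) y)
      ≡⟨ Σ<-cong M (λ u → *-distribʳ-Σ< M (rowTail k (suc u) y) (λ v → K u v * A v)) ⟩
    Σ< M (λ u → Σ< M (λ v → (K u v * A v) * rowTail k (suc u) y))
      ≡⟨ Σ<-comm M M _ ⟩
    Σ< M (λ v → Σ< M (λ u → (K u v * A v) * rowTail k (suc u) y))
      ≡⟨ Σ<-cong M (λ v → trans (Σ<-cong M (λ u → solve 3 (λ a b c → (a :* b) :* c := b :* (a :* c)) refl
                                                               (K u v) (A v) (rowTail k (suc u) y)))
                                (sym (*-distribˡ-Σ< M (A v) _))) ⟩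
    Σ< M (λ v → A v * Σ< M (λ u → K u v * rowTail k (suc u) y))
      ≡⟨ Σ<-cong M (λ v → cong (A v *_) (K-rowTail k y v)) ⟩
    Σ< M (λ v → A v * (invPow (suc v) k * columnSum≥ y v)) ∎
    where
    A : ℕ → ℚ
    A v = zetaStar≥ (suc v) ks

  connected : ∀ ks → All (λ k → 0 < k) ks → Connected ks
  connected [] [] w w<M = begin
    inv (M ∸ w) * zetaStarFlat≥ (suc w) [] ≡⟨ trans (cong (inv (M ∸ w) *_) (zetaStarFlat≥-[] (suc w))) (*-identityʳ _) ⟩
    inv (M ∸ w)                            ≡⟨ sym (K-row-sum w w<M) ⟩
    Σ< M (K w)                             ≡⟨ Σ<-cong M (λ v → sym (trans (cong (K w v *_) (zetaStar≥-[] (suc v))) (*-identityʳ _))) ⟩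
    Σ< M (λ v → K w v * zetaStar≥ (suc v) []) ∎
  connected (suc k ∷ ks) (_ ∷ ks>0) w w<M = begin
    inv (M ∸ w) * zetaStarFlat≥ (suc w) (suc k ∷ ks)
      ≡⟨ cong (inv (M ∸ w) *_) (zetaStarFlat≥-∷-via-K k ks (connected ks ks>0) (suc w)) ⟩
    inv (M ∸ w) * Σ< M (λ v → A v * (invPow (suc v) k * columnSum≥ (suc w) v))
      ≡⟨ *-distribˡ-Σ< M (inv (M ∸ w)) _ ⟩
    Σ< M (λ v → inv (M ∸ w) * (A v * (invPow (suc v) k * columnSum≥ (suc w) v)))
      ≡⟨ Σ<-cong-< M regroup ⟩
    Σ< M (λ v → Σ< M (λ x → K w x when (x ≤ᵇ v)) * (invPow (suc v) (suc k) * A v))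
      ≡⟨ sym (Σ<-triangle M (K w) (λ v → invPow (suc v) (suc k) * A v)) ⟩
    Σ< M (λ x → K w x * Σ< M (λ v → invPow (suc v) (suc k) * A v when (x ≤ᵇ v)))
      ≡⟨ Σ<-cong M (λ x → cong (K w x *_) (sym (zetaStar≥-suc-∷ x))) ⟩
    Σ< M (λ x → K w x * zetaStar≥ (suc x) (suc k ∷ ks)) ∎
    where
    A : ℕ → ℚ
    A v = zetaStar≥ (suc v) ks
    zetaStar≥-suc-∷ : ∀ x → zetaStar≥ (suc x) (suc k ∷ ks) ≡ Σ< M (λ v → invPow (suc v) (suc k) * A v when (x ≤ᵇ v))
    zetaStar≥-suc-∷ x = trans (zetaStar≥-∷ (suc x) (suc k) ks) (Σ<-cong M (λ v → cong (_ when_) (≤ᵇ-suc x v)))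
    regroup : ∀ v → v < M → inv (M ∸ w) * (A v * (invPow (suc v) k * columnSum≥ (suc w) v))
                            ≡ Σ< M (λ x → K w x when (x ≤ᵇ v)) * (invPow (suc v) (suc k) * A v)
    regroup v v<M = begin
      i * (A v * (P * columnSum≥ (suc w) v))
        ≡⟨ solve 4 (λ i a p t → i :* (a :* (p :* t)) := i :* (a :* (p :* t)) :* con 1ℚ) refl i (A v) P (columnSum≥ (suc w) v) ⟩
      i * (A v * (P * columnSum≥ (suc w) v)) * 1ℚ
        ≡⟨ cong (i * (A v * (P * columnSum≥ (suc w) v)) *_) (sym (⌜⌝*inv≡1 {suc v} (s≤s z≤n))) ⟩
      i * (A v * (P * columnSum≥ (suc w) v)) * (⌜ suc v ⌝ * inv (suc v))
        ≡⟨ solve 6 (λ i a p t s q → i :* (a :* (p :* t)) :* (s :* q) := i :* s :* t :* (q :* p :* a)) refl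
                   i (A v) P (columnSum≥ (suc w) v) ⌜ suc v ⌝ (inv (suc v)) ⟩
      i * ⌜ suc v ⌝ * columnSum≥ (suc w) v * (invPow (suc v) (suc k) * A v)
        ≡⟨ cong (λ z → i * ⌜ suc v ⌝ * z * (invPow (suc v) (suc k) * A v)) (columnSum≥-suc w v) ⟩
      i * ⌜ suc v ⌝ * Σ< M (λ u → K u v when (w ≤ᵇ u)) * (invPow (suc v) (suc k) * A v)
        ≡⟨ cong (_* (invPow (suc v) (suc k) * A v)) (sym (K-row-prefix-sum w v w<M v<M)) ⟩
      Σ< M (λ x → K w x when (x ≤ᵇ v)) * (invPow (suc v) (suc k) * A v) ∎
      where
      i = inv (M ∸ w)
      P = invPow (suc v) k

  zetaStar≥0≡zetaStarFlat≥0 : ∀ ks → All (λ k → 0 < k) ks → zetaStar≥ 0 ks ≡ zetaStarFlat≥ 0 ks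
  zetaStar≥0≡zetaStarFlat≥0 [] [] = trans (zetaStar≥-[] 0) (sym (zetaStarFlat≥-[] 0))
  zetaStar≥0≡zetaStarFlat≥0 (suc k ∷ ks) (_ ∷ ks>0) = begin
    zetaStar≥ 0 (suc k ∷ ks)                                                ≡⟨ zetaStar≥-∷ 0 (suc k) ks ⟩
    Σ< M (λ v → invPow (suc v) (suc k) * zetaStar≥ (suc v) ks)              ≡⟨ Σ<-cong-< M regroup ⟩
    Σ< M (λ v → zetaStar≥ (suc v) ks * (invPow (suc v) k * columnSum≥ 0 v)) ≡⟨ sym (zetaStarFlat≥-∷-via-K k ks (connected ks ks>0) 0) ⟩
    zetaStarFlat≥ 0 (suc k ∷ ks)                                            ∎
    where
    regroup : ∀ v → v < M → invPow (suc v) (suc k) * zetaStar≥ (suc v) ks ≡ zetaStar≥ (suc v) ks * (invPow (suc v) k * columnSum≥ 0 v)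
    regroup v v<M = trans (solve 3 (λ a b c → (a :* b) :* c := c :* (b :* a)) refl (inv (suc v)) (invPow (suc v) k) (zetaStar≥ (suc v) ks))
                          (cong (λ z → zetaStar≥ (suc v) ks * (invPow (suc v) k * z)) (sym (K-column-sum v v<M)))

theorem2p1 : (ks : List ℕ) → All (λ k → 0 < k) ks → (N : ℕ) → 0 < N →
    zetaStar N ks ≡ zetaStarFlat N ks
theorem2p1 ks ks>0 (suc M) _ = begin
  zetaStar (suc M) ks     ≡⟨ zetaStar≡zetaStar≥0 ks ⟩
  zetaStar≥ 0 ks          ≡⟨ zetaStar≥0≡zetaStarFlat≥0 ks ks>0 ⟩
  zetaStarFlat≥ 0 ks      ≡⟨ sym (zetaStarFlat≡zetaStarFlat≥0 ks) ⟩
  zetaStarFlat (suc M) ks ∎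
  where
  open Truncated M
  open Connector M
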